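{- A relation $R$ over a finite domain $D$ is blockwise set-decomposable if and only if it is blockwise decomposable.
   Context: For $R\subseteq D^k$ consider the constraint $R(\vec u)$ on pairwise distinct variables with scope $\tilde u$; its solutions are the maps $\beta:\tilde u\to D$ with $(\beta(u_1),\dots,\beta(u_k))\in R$. Projection $\pi_Y$ restricts solutions to $Y$. $R(\vec u)$ (or any set of assignments) is decomposable w.r.t. a partition $(V_1,\dots,V_\ell)$ of its scope if it equals $\pi_{V_1}R(\vec u)\times\cdots\times\pi_{V_\ell}R(\vec u)$. Blockwise decomposable: for distinct $x,y\in\tilde u$, the selection matrix $M^R_{x,y}$ has entries $\pi_{\tilde u\setminus\{x,y\}}(R(\vec u)|_{x=a,y=b})$ ($a,b\in D$); it is a proper block matrix if there are pairwise disjoint nonempty $A_1,\dots,A_k$ and pairwise disjoint nonempty $B_1,\dots,B_k$ with entry $[a,b]$ nonempty iff $a\in A_\ell,b\in B_\ell$ for some $\ell$. $R$ is blockwise decomposable if for all distinct $x,y$, $M^R_{x,y}$ is a proper block matrix and each block constraint $R(\vec u)|_{x\in A_\ell,y\in B_\ell}$ is decomposable w.r.t. some partition $(V_\ell,W_\ell)$ of $\tilde u$ with $x\in V_\ell,y\in W_\ell$. Blockwise set-decomposable: for disjoint nonempty variable sets $\tilde x,\tilde y\subseteq\tilde u$ with $\tilde z=\tilde u\setminus(\tilde x\cup\tilde y)$, let $M^R_{\vec x,\vec y}$ be the matrix with rows indexed by assignments $a:\tilde x\to D$, columns by $b:\tilde y\to D$, and entry $\{c:\tilde z\to D\mid a\cup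 b\cup c\in\mathrm{sol}(R(\vec u))\}$. $R$ is blockwise set-decomposable w.r.t. $\vec x,\vec y$ if $M^R_{\vec x,\vec y}$ is a proper block matrix (same definition, with row/column index sets of assignments) and for every block $A\times C$ the set of solutions $\beta$ with $\beta|_{\tilde x}\in A$ and $\beta|_{\tilde y}\in C$ is decomposable w.r.t. a partition of $\tilde u$ in which no part contains both a variable of $\tilde x$ and a variable of $\tilde y$. $R$ is blockwise set-decomposable if this holds for all choices of disjoint nonempty $\tilde x,\tilde y$. -}

module Defs where

open import Data.Nat using (ℕ)
open import Data.Fin using (Fin)
open import Data.Bool using (Bool; true; false; T)
open import Data.Product using (Σ; ∃; _×_; _,_)
open import Relation.Binary.PropositionalEquality using (_≡_; _≢_)
open import Relation.Nullary using (¬_)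
open import Function.Bundles using (_⇔_)

-- Scope of R(u⃗): the k pairwise distinct variables are identified with Fin k.
-- Domain D = Fin n.  A relation R ⊆ D^k is a predicate on tuples Fin k → Fin n;
-- a (full) assignment / solution candidate β : scope → D is such a tuple.
Tuple : ℕ → ℕ → Set
Tuple k n = Fin k → Fin n

Rel : ℕ → ℕ → Set₁
Rel k n = Tuple k n → Set

VarSet : ℕ → Set
VarSet k = Fin k → Bool

Assign : ∀ {k} → ℕ → VarSet k → Set
Assign {k} n X = (v : Fin k) → T (X v) → Fin n

restrict : ∀ {k n} (X : VarSet k) → Tuple k n → Assign n X
restrict X β v _ = β v

-- A set S of full assignments is decomposable w.r.t. the partition of the
-- scope given by the labelling p (part l = p⁻¹(l)) iff
-- S equals the product of its projections on the parts:
-- γ ∈ S  ⇔  for every part l some β ∈ S agrees with γ on part l.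
Decomposable : ∀ {k n} {L : Set} → (Tuple k n → Set) → (Fin k → L) → Set
Decomposable {k} {n} {L} S p =
  (γ : Tuple k n) →
  S γ ⇔ ((l : L) → ∃ λ β → S β × ((v : Fin k) → p v ≡ l → β v ≡ γ v))

-- Proper block matrix.  Only non-emptiness of entries matters; E r c says
-- entry [r,c] is nonempty.  Blocks are indexed by Fin m; A i, B i are the
-- row / column sets of the i-th block.
record ProperBlock (Row Col : Set) (E : Row → Col → Set) : Set₁ where
  field
    m       : ℕ
    A       : Fin m → Row → Set
    B       : Fin m → Col → Set
    A-disj  : ∀ i j r → A i r → A j r → i ≡ j
    B-disj  : ∀ i j c → B i c → B j c → i ≡ j
    A-ne    : ∀ i → ∃ λ r → A i r
    B-ne    : ∀ i → ∃ λ c → B i c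
    blocks  : ∀ r c → E r c ⇔ (∃ λ i → A i r × B i c)

-- Selection matrix M^R_{x,y}: entry [a,b] = π_{rest}(R|_{x=a,y=b}),
-- nonempty iff some solution has x ↦ a and y ↦ b.
SelNonempty : ∀ {k n} → Rel k n → Fin k → Fin k → Fin n → Fin n → Set
SelNonempty R x y a b = ∃ λ β → R β × β x ≡ a × β y ≡ b

BlockwiseDecomposable : ∀ {k n} → Rel k n → Set₁
BlockwiseDecomposable {k} {n} R =
  (x y : Fin k) → x ≢ y →
  Σ (ProperBlock (Fin n) (Fin n) (SelNonempty R x y)) λ P →
    let open ProperBlock P in
    (i : Fin m) →
      ∃ λ (p : Fin k → Bool) → p x ≡ true × p y ≡ false ×
        Decomposable (λ β → R β × A i (β x) × B i (β y)) p

DisjNonempty : ∀ {k} → VarSet k → VarSet k → Set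
DisjNonempty {k} X Y =
  (∃ λ v → T (X v)) × (∃ λ v → T (Y v)) ×
  ((v : Fin k) → T (X v) → ¬ T (Y v))

-- Matrix M^R_{x⃗,y⃗}: entry [a,b] = {c : z̃ → D | a ∪ b ∪ c ∈ sol R};
-- nonempty iff some solution extends both a and b.
SetSelNonempty : ∀ {k n} → Rel k n → (X Y : VarSet k) →
                 Assign n X → Assign n Y → Set
SetSelNonempty {k} R X Y a b =
  ∃ λ β → R β × ((v : Fin k) (h : T (X v)) → β v ≡ a v h)
              × ((v : Fin k) (h : T (Y v)) → β v ≡ b v h)

BlockwiseSetDecomposableWrt : ∀ {k n} → Rel k n → VarSet k → VarSet k → Set₁
BlockwiseSetDecomposableWrt {k} {n} R X Y =
  Σ (ProperBlock (Assign n X) (Assign n Y) (SetSelNonempty R X Y)) λ P →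
    let open ProperBlock P in
    (i : Fin m) →
      ∃ λ (q : ℕ) → ∃ λ (p : Fin k → Fin q) →
        ((u v : Fin k) → T (X u) → T (Y v) → p u ≢ p v) ×
        Decomposable (λ β → R β × A i (restrict X β) × B i (restrict Y β)) p

BlockwiseSetDecomposable : ∀ {k n} → Rel k n → Set₁
BlockwiseSetDecomposable {k} R =
  (X Y : VarSet k) → DisjNonempty X Y → BlockwiseSetDecomposableWrt R X Y

-- For singletons X = {x}, Y = {y} the two matrices coincide, and a decomposition of a
-- block into q parts coarsens to the two-part partition "the part of x" versus the rest.
-- Conversely, link two solutions β, γ when every entry (β x, γ y) with x ∈ X, y ∈ Y is
-- nonempty. Since every M_{x,y} is a proper block matrix, linking is an equivalence on
-- solutions, and its classes give the blocks of M_{X,Y}. A class lies inside one block of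
-- each M_{x,y}, so it recombines along the partition p_{x,y} of that block; partitions along
-- which a set recombines are closed under common refinement, hence under Boolean
-- combinations, and a Boolean combination of the p_{x,y} separates all of X from all of Y.
-- Decidability of R serves only to enumerate the finitely many classes.

module Submission where

open import Defs
open import Data.Nat using (ℕ; zero; suc)
open import Data.Fin using (Fin; zero; suc; _≟_)
open import Data.Fin.Properties using (any?; all?)
open import Data.Bool using (Bool; true; false; T; not; _∧_; if_then_else_)
open import Data.Bool.Properties using (∧-zeroʳ)
open import Data.Product using (∃; _×_; _,_; proj₁; proj₂; uncurry)
open import Data.Empty using (⊥-elim)
open import Data.List using (List; []; _∷_; allFin; cartesianProductWith)
open import Data.List.Membership.Propositional using (_∈_; lose)
open import Data.List.Membership.Propositional.Properties using (∈-allFin; ∈-cartesianProductWith⁺)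
open import Data.List.Relation.Unary.Any using (here; there; satisfied)
import Data.List.Relation.Unary.Any as Any
import Data.Vec.Functional as Vector
open import Function using (_∘_)
open import Function.Bundles using (_⇔_; mk⇔; Equivalence)
open import Relation.Binary.PropositionalEquality using (_≡_; _≢_; refl; sym; trans; cong; cong₂; subst; subst₂)
open import Relation.Nullary using (¬_; Dec; yes; no; does)
open import Relation.Nullary.Decidable using (_×-dec_; _→-dec_; ⌊_⌋; T?; toWitness; fromWitness; dec-true; dec-false)
open import Relation.Unary using (Decidable)

open Equivalence

private variable
  k n : ℕ
  L L′ : Set
  S S′ : Tuple k n → Set

Extensional : (Tuple k n → Set) → Set
Extensional {k} {n} S = ∀ {β γ : Tuple k n} → S β → (∀ v → β v ≡ γ v) → S γ

Glues : (Tuple k n → Set) → (Fin k → L) → Set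
Glues {k} {n} {L} S p =
  ∀ γ → ((l : L) → ∃ λ β → S β × (∀ v → p v ≡ l → β v ≡ γ v)) → S γ

decomposable⇔glues : {p : Fin k → L} → Decomposable S p ⇔ Glues S p
decomposable⇔glues = mk⇔ (λ D γ → from (D γ))
                         (λ G γ → mk⇔ (λ s _ → γ , s , λ _ _ → refl) (G γ))

glues⇒extensional : {p : Fin k → L} → Glues S p → Extensional S
glues⇒extensional G {β} s β≗γ = G _ (λ _ → β , s , λ v _ → β≗γ v)

glues-mix : {p : Fin k → L} → Glues S p →
            (β : L → Tuple k n) → (∀ l → S (β l)) → S (λ v → β (p v) v)
glues-mix G β s = G _ (λ l → β l , s l , λ v pv≡l → cong (λ l′ → β l′ v) (sym pv≡l))

glues-coarsen : {p : Fin k → L} (c : L → L′) → Glues S p → Glues S (c ∘ p)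
glues-coarsen c G γ w =
  G γ (λ l → let β , s , agree = w (c l) in β , s , λ v pv≡l → agree v (cong c pv≡l))

glues-pair : {L L′ : Set} {S : Tuple k n → Set} {p : Fin k → L} {q : Fin k → L′} →
             Glues S p → Glues S q → Glues S (λ v → p v , q v)
glues-pair {k} {n} {L} {L′} {p = p} {q = q} Gp Gq γ w =
  Gp γ (λ l → δ l , glues-mix Gq (β l) (λ l′ → proj₁ (proj₂ (w (l , l′)))) , agree l)
  where
    β : L → L′ → Tuple k n
    β l l′ = proj₁ (w (l , l′))
    δ : L → Tuple k n
    δ l v = β l (q v) v
    agree : ∀ l v → p v ≡ l → δ l v ≡ γ v
    agree l v pv≡l = proj₂ (proj₂ (w (l , q v))) v (cong (_, q v) pv≡l)

glues-resp : {p : Fin k → L} → (∀ β → S β ⇔ S′ β) → Glues S p → Glues S′ p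
glues-resp S⇔S′ G γ w =
  to (S⇔S′ γ) (G γ (λ l → let β , s , agree = w l in β , from (S⇔S′ β) s , agree))

glues-∩-pointwise : {p : Fin k → L} (Q : Fin k → Fin n → Set) → Glues S p →
                    Glues (λ β → S β × ∀ v → Q v (β v)) p
glues-∩-pointwise {p = p} Q G γ w =
  G γ (λ l → let β , (s , _) , agree = w l in β , s , agree) ,
  λ v → let β , (_ , q) , agree = w (p v) in subst (Q v) (agree v refl) (q v)

module Separation {k : ℕ} (𝓕 : (Fin k → Bool) → Set)
                  (𝓕-true : 𝓕 (λ _ → true))
                  (𝓕-not : ∀ {f} → 𝓕 f → 𝓕 (not ∘ f))
                  (𝓕-∧ : ∀ {f g} → 𝓕 f → 𝓕 g → 𝓕 (λ v → f v ∧ g v)) where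

  separate : (W Z : Fin k → Set) → Decidable Z →
             (∀ z → Z z → ∃ λ f → 𝓕 f × (∀ w → W w → f w ≡ true) × f z ≡ false) →
             ∃ λ f → 𝓕 f × (∀ w → W w → f w ≡ true) × (∀ z → Z z → f z ≡ false)
  separate W Z Z? sep =
    let f , 𝓕f , fW , fZ = over (allFin k) in f , 𝓕f , fW , λ z → fZ z (∈-allFin z)
    where
      over : (zs : List (Fin k)) →
             ∃ λ f → 𝓕 f × (∀ w → W w → f w ≡ true) × (∀ z → z ∈ zs → Z z → f z ≡ false)
      over [] = (λ _ → true) , 𝓕-true , (λ _ _ → refl) , λ _ ()
      over (z ∷ zs) with over zs | Z? z
      ... | f , 𝓕f , fW , fZ | no ¬Zz =
        f , 𝓕f , fW , λ { _ (here refl) Zz → ⊥-elim (¬Zz Zz) ; z′ (there z′∈zs) → fZ z′ z′∈zs }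
      ... | f , 𝓕f , fW , fZ | yes Zz =
        let g , 𝓕g , gW , gz = sep z Zz in
        (λ v → g v ∧ f v) , 𝓕-∧ 𝓕g 𝓕f ,
        (λ w Ww → cong₂ _∧_ (gW w Ww) (fW w Ww)) ,
        λ { _ (here refl) _ → cong (_∧ f z) gz
          ; z′ (there z′∈zs) Zz′ → trans (cong (g z′ ∧_) (fZ z′ z′∈zs Zz′)) (∧-zeroʳ (g z′)) }

  separate-sets : (X Y : Fin k → Set) → Decidable X → Decidable Y →
                  (∀ x y → X x → Y y → ∃ λ f → 𝓕 f × f x ≡ true × f y ≡ false) →
                  ∃ λ f → 𝓕 f × (∀ x → X x → f x ≡ true) × (∀ y → Y y → f y ≡ false)
  separate-sets X Y X? Y? sep =
    let g , 𝓕g , gY , gX = separate Y X X? separateFromY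
    in not ∘ g , 𝓕-not 𝓕g , (λ x Xx → cong not (gX x Xx)) , λ y Yy → cong not (gY y Yy)
    where
      separateFromY : ∀ x → X x → ∃ λ f → 𝓕 f × (∀ y → Y y → f y ≡ true) × f x ≡ false
      separateFromY x Xx =
        let f , 𝓕f , fx , fY = separate (_≡ x) Y Y?
              (λ y Yy → let f , 𝓕f , fx , fy = sep x y Xx Yy in f , 𝓕f , (λ { _ refl → fx }) , fy)
        in not ∘ f , 𝓕-not 𝓕f , (λ y Yy → cong not (fY y Yy)) , cong not (fx x refl)

module _ {Row Col : Set} {E : Row → Col → Set} (P : ProperBlock Row Col E) where
  open ProperBlock P

  entry⇒A : ∀ {i r c} → E r c → B i c → A i r
  entry⇒A {i} {r} {c} e c∈Bi with to (blocks r c) e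
  ... | j , r∈Aj , c∈Bj with B-disj j i c c∈Bj c∈Bi
  ... | refl = r∈Aj

  entry⇒B : ∀ {i r c} → E r c → A i r → B i c
  entry⇒B {i} {r} {c} e r∈Ai with to (blocks r c) e
  ... | j , r∈Aj , c∈Bj with A-disj j i r r∈Aj r∈Ai
  ... | refl = c∈Bj

  zigzag : ∀ {r r′ c c′} → E r c → E r′ c → E r′ c′ → E r c′
  zigzag {r} {r′} {c} {c′} e₁ e₂ e₃ =
    let i , r′∈Ai , c′∈Bi = to (blocks r′ c′) e₃
    in from (blocks r c′) (i , entry⇒A e₁ (entry⇒B e₂ r′∈Ai) , c′∈Bi)

  A-transport : ∀ {i r r′} → A i r → (∀ {c} → E r c → E r′ c) → A i r′
  A-transport {i} {r} r∈Ai E⇒ =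
    let c , c∈Bi = B-ne i in entry⇒A (E⇒ (from (blocks r c) (i , r∈Ai , c∈Bi))) c∈Bi

  B-transport : ∀ {i c c′} → B i c → (∀ {r} → E r c → E r c′) → B i c′
  B-transport {i} {c} c∈Bi E⇒ =
    let r , r∈Ai = A-ne i in entry⇒B (E⇒ (from (blocks r c) (i , r∈Ai , c∈Bi))) r∈Ai

  reindex : {Row′ Col′ : Set} {E′ : Row′ → Col′ → Set} (f : Row′ → Row) (g : Col′ → Col) →
            (∀ r c → E′ r c ⇔ E (f r) (g c)) →
            (∀ r → ∃ λ r′ → ∀ {c} → E r c → E (f r′) c) →
            (∀ c → ∃ λ c′ → ∀ {r} → E r c → E r (g c′)) →
            ProperBlock Row′ Col′ E′
  reindex f g E′⇔E rows cols = record
    { m = m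
    ; A = λ i r → A i (f r)
    ; B = λ i c → B i (g c)
    ; A-disj = λ i j r → A-disj i j (f r)
    ; B-disj = λ i j c → B-disj i j (g c)
    ; A-ne = λ i → let r , r∈Ai = A-ne i ; r′ , E⇒ = rows r in r′ , A-transport r∈Ai E⇒
    ; B-ne = λ i → let c , c∈Bi = B-ne i ; c′ , E⇒ = cols c in c′ , B-transport c∈Bi E⇒
    ; blocks = λ r c → mk⇔ (to (blocks (f r) (g c)) ∘ to (E′⇔E r c))
                           (from (E′⇔E r c) ∘ from (blocks (f r) (g c)))
    }

allTuples : (k n : ℕ) → List (Tuple k n)
allTuples zero    n = (λ ()) ∷ []
allTuples (suc k) n = cartesianProductWith Vector._∷_ (allFin n) (allTuples k n)

allTuples-complete : (β : Tuple k n) → ∃ λ t → t ∈ allTuples k n × (∀ v → t v ≡ β v)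
allTuples-complete {zero}  β = (λ ()) , here refl , λ ()
allTuples-complete {suc k} β =
  let t , t∈ , t≗β = allTuples-complete (β ∘ suc)
  in β zero Vector.∷ t , ∈-cartesianProductWith⁺ Vector._∷_ (∈-allFin (β zero)) t∈ ,
     λ { zero → refl ; (suc v) → t≗β v }

any-tuple? : Extensional S → Decidable S → Dec (∃ S)
any-tuple? ext S? with Any.any? S? (allTuples _ _)
... | yes some = yes (satisfied some)
... | no none = no λ (β , s) →
  let t , t∈ , t≗β = allTuples-complete β in none (lose t∈ (ext s (sym ∘ t≗β)))

selNonempty? : {R : Rel k n} → Extensional R → Decidable R →
               ∀ x y a b → Dec (SelNonempty R x y a b)
selNonempty? R-ext R? x y a b =
  any-tuple? (λ (r , βx≡a , βy≡b) β≗γ → R-ext r β≗γ , trans (sym (β≗γ x)) βx≡a ,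
                                                      trans (sym (β≗γ y)) βy≡b)
             (λ β → R? β ×-dec (β x ≟ a ×-dec β y ≟ b))

record Representatives {T : Set} (Q : T → Set) (_~_ : T → T → Set) (ts : List T) : Set where
  field
    m             : ℕ
    rep           : Fin m → T
    rep-Q         : ∀ i → Q (rep i)
    rep-injective : ∀ i j → rep i ~ rep j → i ≡ j
    cover         : ∀ t → t ∈ ts → Q t → ∃ λ i → t ~ rep i

module _ {T : Set} {Q : T → Set} {_~_ : T → T → Set}
         (Q? : Decidable Q) (_~?_ : ∀ s t → Dec (s ~ t))
         (~-refl : ∀ {t} → Q t → t ~ t) (~-sym : ∀ {s t} → Q s → Q t → s ~ t → t ~ s) where

  private
    keep : ∀ {t ts} (Rs : Representatives Q _~_ ts) →
           (Q t → ∃ λ i → t ~ Representatives.rep Rs i) → Representatives Q _~_ (t ∷ ts)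
    keep Rs covered = record
      { m = m ; rep = rep ; rep-Q = rep-Q ; rep-injective = rep-injective
      ; cover = λ { _ (here refl) → covered ; t′ (there t′∈ts) → cover t′ t′∈ts }
      }
      where open Representatives Rs

    adjoin : ∀ {t ts} (Rs : Representatives Q _~_ ts) → Q t →
             ¬ (∃ λ i → t ~ Representatives.rep Rs i) → Representatives Q _~_ (t ∷ ts)
    adjoin {t} {ts} Rs Qt new = record
      { m = suc m
      ; rep = t Vector.∷ rep
      ; rep-Q = λ { zero → Qt ; (suc i) → rep-Q i }
      ; rep-injective = injective
      ; cover = covers
      }
      where
        open Representatives Rs
        injective : ∀ i j → (t Vector.∷ rep) i ~ (t Vector.∷ rep) j → i ≡ j
        injective zero    zero    _   = refl
        injective zero    (suc j) t~j = ⊥-elim (new (j , t~j))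
        injective (suc i) zero    i~t = ⊥-elim (new (i , ~-sym (rep-Q i) Qt i~t))
        injective (suc i) (suc j) i~j = cong suc (rep-injective i j i~j)
        covers : ∀ t′ → t′ ∈ t ∷ ts → Q t′ → ∃ λ i → t′ ~ (t Vector.∷ rep) i
        covers _  (here refl)   _   = zero , ~-refl Qt
        covers t′ (there t′∈ts) Qt′ = let i , t′~i = cover t′ t′∈ts Qt′ in suc i , t′~i

  representatives : (ts : List T) → Representatives Q _~_ ts
  representatives [] = record
    { m = 0 ; rep = λ () ; rep-Q = λ () ; rep-injective = λ () ; cover = λ _ () }
  representatives (t ∷ ts) with representatives ts | Q? t
  ... | Rs | no ¬Qt = keep Rs (λ Qt → ⊥-elim (¬Qt Qt))
  ... | Rs | yes Qt with any? (λ i → t ~? Representatives.rep Rs i)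
  ...   | yes t~rep = keep Rs (λ _ → t~rep)
  ...   | no  t≁rep = adjoin Rs Qt t≁rep

singleton : Fin k → VarSet k
singleton x v = ⌊ v ≟ x ⌋

module FromSetDecomposition {R : Rel k n} (sd : BlockwiseSetDecomposable R)
                            {x y : Fin k} (x≢y : x ≢ y) where

  X Y : VarSet k
  X = singleton x
  Y = singleton y

  x∈X : T (X x)
  x∈X = fromWitness refl

  y∈Y : T (Y y)
  y∈Y = fromWitness refl

  constant : {Z : VarSet k} → Fin n → Assign n Z
  constant a _ _ = a

  agrees-onX : {β : Tuple k n} {a : Fin n} → β x ≡ a → ∀ v → T (X v) → β v ≡ a
  agrees-onX {β} βx≡a v v∈X = trans (cong β (toWitness v∈X)) βx≡a

  agrees-onY : {β : Tuple k n} {b : Fin n} → β y ≡ b → ∀ v → T (Y v) → β v ≡ b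
  agrees-onY {β} βy≡b v v∈Y = trans (cong β (toWitness v∈Y)) βy≡b

  SetSel : Assign n X → Assign n Y → Set
  SetSel = SetSelNonempty R X Y

  setSel-respˡ : ∀ {a a′ b} → (∀ v h → a v h ≡ a′ v h) → SetSel a b → SetSel a′ b
  setSel-respˡ a≗a′ (β , r , β≗a , β≗b) = β , r , (λ v h → trans (β≗a v h) (a≗a′ v h)) , β≗b

  setSel-respʳ : ∀ {a b b′} → (∀ v h → b v h ≡ b′ v h) → SetSel a b → SetSel a b′
  setSel-respʳ b≗b′ (β , r , β≗a , β≗b) = β , r , β≗a , λ v h → trans (β≗b v h) (b≗b′ v h)

  sel⇔setSel : ∀ a b → SelNonempty R x y a b ⇔ SetSel (constant a) (constant b)
  sel⇔setSel a b = mk⇔ (λ (β , r , βx≡a , βy≡b) → β , r , agrees-onX βx≡a , agrees-onY βy≡b)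
                       (λ (β , r , onX , onY) → β , r , onX x x∈X , onY y y∈Y)

  disjoint : DisjNonempty X Y
  disjoint = (x , x∈X) , (y , y∈Y) , λ v v∈X v∈Y → x≢y (trans (sym (toWitness v∈X)) (toWitness v∈Y))

  P : ProperBlock (Assign n X) (Assign n Y) SetSel
  P = proj₁ (sd X Y disjoint)
  open ProperBlock P using (m; A; B)

  P′ : ProperBlock (Fin n) (Fin n) (SelNonempty R x y)
  P′ = reindex P constant constant sel⇔setSel
    (λ a → a x x∈X , λ (β , r , onX , onY) → β , r , agrees-onX (onX x x∈X) , onY)
    (λ b → b y y∈Y , λ (β , r , onX , onY) → β , r , onX , agrees-onY (onY y y∈Y))

  restrict⇔constant : ∀ i β → (R β × A i (restrict X β) × B i (restrict Y β)) ⇔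
                               (R β × A i (constant (β x)) × B i (constant (β y)))
  restrict⇔constant i β = mk⇔
    (λ (r , a , b) → r , A-transport P a (setSel-respˡ (agrees-onX refl))
                       , B-transport P b (setSel-respʳ (agrees-onY refl)))
    (λ (r , a , b) → r , A-transport P a (setSel-respˡ λ v h → sym (agrees-onX refl v h))
                       , B-transport P b (setSel-respʳ λ v h → sym (agrees-onY refl v h)))

  decompose : (i : Fin m) → ∃ λ (p : Fin k → Bool) → p x ≡ true × p y ≡ false ×
                Decomposable (λ β → R β × A i (constant (β x)) × B i (constant (β y))) p
  decompose i =
    let _ , p , separated , D = proj₂ (sd X Y disjoint) i
        sameAsX = λ l → does (l ≟ p x)
    in sameAsX ∘ p , dec-true (p x ≟ p x) refl ,
       dec-false (p y ≟ p x) (λ e → separated x y x∈X y∈Y (sym e)) ,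
       from decomposable⇔glues
         (glues-coarsen sameAsX (glues-resp (restrict⇔constant i) (to decomposable⇔glues D)))

blockwiseSetDecomposable⇒blockwiseDecomposable : {R : Rel k n} →
  BlockwiseSetDecomposable R → BlockwiseDecomposable R
blockwiseSetDecomposable⇒blockwiseDecomposable sd x y x≢y =
  FromSetDecomposition.P′ sd x≢y , FromSetDecomposition.decompose sd x≢y

-- Tuples are only enumerated up to pointwise equality, so enumeration needs R extensional.
blockwiseDecomposable⇒extensional : {R : Rel k n} → BlockwiseDecomposable R →
                                    {x y : Fin k} → x ≢ y → Extensional R
blockwiseDecomposable⇒extensional {R = R} bd {x} {y} x≢y {β} r β≗γ
  with bd x y x≢y
... | P , decompose with to (ProperBlock.blocks P (β x) (β y)) (β , r , refl , refl)
... | i , βx∈Ai , βy∈Bi with decompose i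
... | _ , _ , _ , D =
  proj₁ (glues⇒extensional (to decomposable⇔glues D) (r , βx∈Ai , βy∈Bi) β≗γ)

module ToSetDecomposition {R : Rel k n} (R? : Decidable R) (bd : BlockwiseDecomposable R)
                          {X Y : VarSet k} {x₀ y₀ : Fin k} (x₀∈X : T (X x₀)) (y₀∈Y : T (Y y₀))
                          (X∩Y=∅ : ∀ v → T (X v) → ¬ T (Y v)) where

  distinct : ∀ {x y} → T (X x) → T (Y y) → x ≢ y
  distinct x∈X y∈Y refl = X∩Y=∅ _ x∈X y∈Y

  R-ext : Extensional R
  R-ext = blockwiseDecomposable⇒extensional bd (distinct x₀∈X y₀∈Y)

  selection : ∀ {x y} → T (X x) → T (Y y) → ProperBlock (Fin n) (Fin n) (SelNonempty R x y)
  selection x∈X y∈Y = proj₁ (bd _ _ (distinct x∈X y∈Y))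

  Linked : Tuple k n → Fin k → Fin n → Set
  Linked γ x a = ∀ y → T (X x) → T (Y y) → SelNonempty R x y a (γ y)

  _~_ : Tuple k n → Tuple k n → Set
  β ~ γ = ∀ x → Linked γ x (β x)

  diagonal : ∀ {β x y} → R β → SelNonempty R x y (β x) (β y)
  diagonal {β} r = β , r , refl , refl

  ~-refl : ∀ {β} → R β → β ~ β
  ~-refl r _ _ _ _ = diagonal r

  ~-sym : ∀ {β γ} → R β → R γ → β ~ γ → γ ~ β
  ~-sym rβ rγ β~γ x y x∈X y∈Y =
    zigzag (selection x∈X y∈Y) (diagonal rγ) (β~γ x y x∈X y∈Y) (diagonal rβ)

  ~-trans : ∀ {β γ δ} → R γ → β ~ γ → γ ~ δ → β ~ δ
  ~-trans rγ β~γ γ~δ x y x∈X y∈Y =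
    zigzag (selection x∈X y∈Y) (β~γ x y x∈X y∈Y) (diagonal rγ) (γ~δ x y x∈X y∈Y)

  ~-agreeX : ∀ {β β′} → R β′ → (∀ v → T (X v) → β v ≡ β′ v) → β ~ β′
  ~-agreeX {β′ = β′} r′ β≗β′ x _ x∈X _ = β′ , r′ , sym (β≗β′ x x∈X) , refl

  ~-agreeY : ∀ {β β′} → R β → (∀ v → T (Y v) → β v ≡ β′ v) → β ~ β′
  ~-agreeY {β} r β≗β′ _ y _ y∈Y = β , r , refl , β≗β′ y y∈Y

  _~?_ : ∀ β γ → Dec (β ~ γ)
  β ~? γ = all? λ x → all? λ y → T? (X x) →-dec (T? (Y y) →-dec
             selNonempty? R-ext R? x y (β x) (γ y))

  open Representatives (representatives R? _~?_ ~-refl ~-sym (allTuples k n))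

  Class : Fin m → Tuple k n → Set
  Class i β = R β × β ~ rep i

  classOf : ∀ {β} → R β → ∃ λ i → Class i β
  classOf {β} r =
    let t , t∈ , t≗β = allTuples-complete β
        i , t~i = cover t t∈ (R-ext r (sym ∘ t≗β))
    in i , r , λ x → subst (Linked (rep i) x) (t≗β x) (t~i x)

  class-unique : ∀ {i j β γ} → Class i β → Class j γ → β ~ γ → i ≡ j
  class-unique {i} {j} (rβ , β~i) (rγ , γ~j) β~γ =
    rep-injective i j (~-trans rγ (~-trans rβ (~-sym rβ (rep-Q i) β~i) β~γ) γ~j)

  class-glues-pair : ∀ i {x y} → T (X x) → T (Y y) →
                     ∃ λ p → p x ≡ true × p y ≡ false × Glues (Class i) p
  class-glues-pair i {x} {y} x∈X y∈Y with bd x y (distinct x∈X y∈Y)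
  ... | P , decompose with to (ProperBlock.blocks P (rep i x) (rep i y)) (diagonal (rep-Q i))
  ... | j , _ , repy∈Bj with decompose j
  ... | p , px , py , D =
    p , px , py ,
    glues-resp blockClass⇔Class
      (glues-∩-pointwise (Linked (rep i)) (to decomposable⇔glues D))
    where
      open ProperBlock P using (A; B)
      blockClass⇔Class : ∀ β → ((R β × A j (β x) × B j (β y)) × β ~ rep i) ⇔ Class i β
      blockClass⇔Class β = mk⇔ (λ ((r , _) , β~i) → r , β~i)
        λ (r , β~i) → let βx∈Aj = entry⇒A P (β~i x y x∈X y∈Y) repy∈Bj
                      in (r , βx∈Aj , entry⇒B P (diagonal r) βx∈Aj) , β~i

  class-glues-true : ∀ i → Glues (Class i) (λ _ → true)
  class-glues-true i =
    let _ , _ , _ , G = class-glues-pair i x₀∈X y₀∈Y in glues-coarsen (λ (_ : Bool) → true) G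

  -- Unfolding the separator during conversion checking is prohibitively expensive.
  opaque
    separator : ∀ i → ∃ λ f → Glues (Class i) f × (∀ x → T (X x) → f x ≡ true)
                                                 × (∀ y → T (Y y) → f y ≡ false)
    separator i = separate-sets (T ∘ X) (T ∘ Y) (T? ∘ X) (T? ∘ Y)
      λ x y x∈X y∈Y → let p , px , py , G = class-glues-pair i x∈X y∈Y in p , G , px , py
      where
        open Separation (Glues (Class i)) (class-glues-true i) (glues-coarsen not)
          (λ Gf Gg → glues-coarsen (uncurry _∧_) (glues-pair Gf Gg))

  Rows : Fin m → Assign n X → Set
  Rows i a = ∃ λ β → Class i β × (∀ v h → β v ≡ a v h)

  Cols : Fin m → Assign n Y → Set
  Cols i b = ∃ λ β → Class i β × (∀ v h → β v ≡ b v h)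

  glue-row-col : ∀ {i a b} → Rows i a → Cols i b → SetSelNonempty R X Y a b
  glue-row-col {i} (β₁ , c₁ , β₁≗a) (β₂ , c₂ , β₂≗b) with separator i
  ... | f , G , fX , fY =
    γ , proj₁ (glues-mix G choose λ { true → c₁ ; false → c₂ }) ,
    (λ v v∈X → trans (cong (λ l → choose l v) (fX v v∈X)) (β₁≗a v v∈X)) ,
    (λ v v∈Y → trans (cong (λ l → choose l v) (fY v v∈Y)) (β₂≗b v v∈Y))
    where
      choose : Bool → Tuple k n
      choose l = if l then β₁ else β₂
      γ : Tuple k n
      γ v = choose (f v) v

  blockMatrix : ProperBlock (Assign n X) (Assign n Y) (SetSelNonempty R X Y)
  blockMatrix = record
    { m = m
    ; A = Rows
    ; B = Cols
    ; A-disj = λ { i j a (β , cβ , β≗a) (β′ , cβ′ , β′≗a) →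
        class-unique cβ cβ′ (~-agreeX (proj₁ cβ′) λ v h → trans (β≗a v h) (sym (β′≗a v h))) }
    ; B-disj = λ { i j b (β , cβ , β≗b) (β′ , cβ′ , β′≗b) →
        class-unique cβ cβ′ (~-agreeY (proj₁ cβ) λ v h → trans (β≗b v h) (sym (β′≗b v h))) }
    ; A-ne = λ i → restrict X (rep i) , rep i , (rep-Q i , ~-refl (rep-Q i)) , λ _ _ → refl
    ; B-ne = λ i → restrict Y (rep i) , rep i , (rep-Q i , ~-refl (rep-Q i)) , λ _ _ → refl
    ; blocks = λ a b → mk⇔
        (λ (β , r , β≗a , β≗b) → let i , c = classOf r in i , (β , c , β≗a) , (β , c , β≗b))
        (λ (i , row , col) → glue-row-col row col)
    }

  Class⇔block : ∀ i β → Class i β ⇔ (R β × Rows i (restrict X β) × Cols i (restrict Y β))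
  Class⇔block i β = mk⇔
    (λ c → proj₁ c , (β , c , λ _ _ → refl) , (β , c , λ _ _ → refl))
    (λ (r , (β′ , (r′ , β′~i) , β′≗β) , _) → r , ~-trans r′ (~-agreeX r′ (λ v h → sym (β′≗β v h))) β′~i)

  decompose : ∀ i → ∃ λ q → ∃ λ (p : Fin k → Fin q) →
                ((u v : Fin k) → T (X u) → T (Y v) → p u ≢ p v) ×
                Decomposable (λ β → R β × Rows i (restrict X β) × Cols i (restrict Y β)) p
  decompose i with separator i
  ... | f , G , fX , fY =
    2 , bit ∘ f , separated ,
    from decomposable⇔glues (glues-coarsen bit (glues-resp (Class⇔block i) G))
    where
      bit : Bool → Fin 2
      bit l = if l then zero else suc zero
      separated : (u v : Fin k) → T (X u) → T (Y v) → bit (f u) ≢ bit (f v)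
      separated u v u∈X v∈Y =
        subst₂ (λ a b → bit a ≢ bit b) (sym (fX u u∈X)) (sym (fY v v∈Y)) λ ()

blockwiseDecomposable⇒blockwiseSetDecomposable : {R : Rel k n} → Decidable R →
  BlockwiseDecomposable R → BlockwiseSetDecomposable R
blockwiseDecomposable⇒blockwiseSetDecomposable R? bd X Y ((_ , x₀∈X) , (_ , y₀∈Y) , X∩Y=∅) =
  blockMatrix , decompose
  where open ToSetDecomposition R? bd x₀∈X y₀∈Y X∩Y=∅

lemma21 : (k n : ℕ) (R : Rel k n) → Decidable R →
          BlockwiseSetDecomposable R ⇔ BlockwiseDecomposable R
lemma21 k n R R? = mk⇔ blockwiseSetDecomposable⇒blockwiseDecomposable
                       (blockwiseDecomposable⇒blockwiseSetDecomposable R?)
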